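{- The set of regular time warps is closed under $\wedge$, $\vee$, $\circ$, ${}'$ and contains $\mathrm{id}$; that is, it forms a subalgebra $\mathbf{R}$ of the time warp algebra $\mathbf{W}$.
   Context: Let $\omega^+=\omega\cup\{\omega\}$ with its natural order. A time warp is a join-preserving map $f\colon\omega^+\to\omega^+$ (equivalently, order-preserving with $f(0)=0$ and $f(\omega)=\sup_{n\in\omega}f(n)$). Let $p$ be the predecessor time warp ($p(0)=0$, $p(\omega)=\omega$, $p(m)=m-1$ for $0<m<\omega$). The time warp algebra $\mathbf{W}=\langle W,\wedge,\vee,\circ,{}',\mathrm{id}\rangle$ has pointwise $\wedge,\vee$, composition $\circ$, the identity $\mathrm{id}$, and $f'$ the largest time warp $g$ with $f\circ g\le p$ pointwise. A time warp $f$ is eventually constant if there is $m\in\omega$ with $f(n)=f(m)$ for all $n\in\omega$ with $n\ge m$; eventually linear if there are $m\in\omega$, $k\in\mathbb{Z}$ with $f(n)=n+k$ for all $n\in\omega$ with $n\ge m$; and regular if it is eventually constant or eventually linear. -}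

module Defs where

open import Data.Nat using (ℕ; zero; suc; _≤_; _⊓_; _⊔_)
open import Data.Integer as ℤ using (ℤ; +_)
open import Data.Product using (Σ; _×_; ∃)
open import Relation.Binary.PropositionalEquality using (_≡_)

data ω⁺ : Set where
  fin : ℕ → ω⁺
  ω   : ω⁺

data _≤ω_ : ω⁺ → ω⁺ → Set where
  fin≤fin : ∀ {m n} → m ≤ n → fin m ≤ω fin n
  x≤ω     : ∀ {x} → x ≤ω ω

_⊓ω_ : ω⁺ → ω⁺ → ω⁺
fin m ⊓ω fin n = fin (m ⊓ n)
fin m ⊓ω ω     = fin m
ω     ⊓ω y     = y

_⊔ω_ : ω⁺ → ω⁺ → ω⁺
fin m ⊔ω fin n = fin (m ⊔ n)
fin m ⊔ω ω     = ω
ω     ⊔ω y     = ω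

record IsTimeWarp (f : ω⁺ → ω⁺) : Set where
  field
    monotone : ∀ x y → x ≤ω y → f x ≤ω f y
    zero↦0   : f (fin 0) ≡ fin 0
    ω-upper  : ∀ n → f (fin n) ≤ω f ω
    ω-least  : ∀ u → (∀ n → f (fin n) ≤ω u) → f ω ≤ω u

_∧_ : (ω⁺ → ω⁺) → (ω⁺ → ω⁺) → (ω⁺ → ω⁺)
(f ∧ g) x = f x ⊓ω g x

_∨_ : (ω⁺ → ω⁺) → (ω⁺ → ω⁺) → (ω⁺ → ω⁺)
(f ∨ g) x = f x ⊔ω g x

_∘w_ : (ω⁺ → ω⁺) → (ω⁺ → ω⁺) → (ω⁺ → ω⁺)
(f ∘w g) x = f (g x)

idw : ω⁺ → ω⁺
idw x = x

p : ω⁺ → ω⁺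
p (fin zero)    = fin zero
p (fin (suc m)) = fin m
p ω             = ω

_≤ₚ_ : (ω⁺ → ω⁺) → (ω⁺ → ω⁺) → Set
f ≤ₚ g = ∀ x → f x ≤ω g x

IsResidual : (ω⁺ → ω⁺) → (ω⁺ → ω⁺) → Set
IsResidual f g =
  IsTimeWarp g × ((f ∘w g) ≤ₚ p) ×
  (∀ (h : ω⁺ → ω⁺) → IsTimeWarp h → (f ∘w h) ≤ₚ p → h ≤ₚ g)

EventuallyConstant : (ω⁺ → ω⁺) → Set
EventuallyConstant f = Σ ℕ λ m → ∀ n → m ≤ n → f (fin n) ≡ f (fin m)

EventuallyLinear : (ω⁺ → ω⁺) → Set
EventuallyLinear f = Σ ℕ λ m → Σ ℤ λ k → ∀ n → m ≤ n →
  Σ ℕ λ j → (f (fin n) ≡ fin j) × ((+ j) ≡ (+ n) ℤ.+ k)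

data Regular (f : ω⁺ → ω⁺) : Set where
  evConst : EventuallyConstant f → Regular f
  evLin   : EventuallyLinear f → Regular f

-- On ω a regular time warp eventually agrees, up to a shift, with a constant
-- tail d ↦ v or a linear tail d ↦ c + d. Meets and joins of two tails, and f
-- applied to a tail, are again eventually tails, so only thresholds need aligning.
-- For the residual, f' x is the largest y with f y ≤ x − 1. If f (m + d) = c + d
-- eventually, this is m + d for x = c + 1 + d; if f is eventually a finite b,
-- then f ω ≤ b and it is ω; if f is eventually ω, it is the last point before
-- f jumps to ω.
module Submission where

open import Defs
open import Data.Empty using (⊥-elim)
open import Data.Nat as ℕ using (ℕ; zero; suc; _+_; _≤_; z≤n; s≤s)
open import Data.Nat.Properties
open import Data.Integer as ℤ using (+_)
import Data.Integer.Properties as ℤₚ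
import Algebra.Properties.CommutativeSemigroup as CommutativeSemigroupProperties
open CommutativeSemigroupProperties +-commutativeSemigroup using (x∙yz≈y∙xz)
open CommutativeSemigroupProperties ℤₚ.+-commutativeSemigroup using (xy∙z≈xz∙y)
open import Data.Integer.Tactic.RingSolver using (solve-∀)
open import Data.Product using (Σ; _×_; _,_)
open import Data.Sum using (_⊎_; inj₁; inj₂)
open import Relation.Nullary using (¬_; yes; no)
open import Function using (_∘_)
open import Relation.Binary.PropositionalEquality

private
  variable
    f f' : ω⁺ → ω⁺
    σ τ : ℕ → ω⁺
    a b m n : ℕ
    x y : ω⁺

≤ω-refl : x ≤ω x
≤ω-refl {fin m} = fin≤fin ≤-refl
≤ω-refl {ω}     = x≤ω

≤ω-reflexive : x ≡ y → x ≤ω y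
≤ω-reflexive refl = ≤ω-refl

≤ω-trans : ∀ {z} → x ≤ω y → y ≤ω z → x ≤ω z
≤ω-trans (fin≤fin p) (fin≤fin q) = fin≤fin (≤-trans p q)
≤ω-trans _           x≤ω         = x≤ω

≤ω-antisym : x ≤ω y → y ≤ω x → x ≡ y
≤ω-antisym (fin≤fin p) (fin≤fin q) = cong fin (≤-antisym p q)
≤ω-antisym x≤ω         x≤ω         = refl

0≤ω : fin 0 ≤ω x
0≤ω {fin m} = fin≤fin z≤n
0≤ω {ω}     = x≤ω

ω≰fin : ¬ ω ≤ω fin n
ω≰fin ()

1+n≰ωn : ¬ fin (suc n) ≤ω fin n
1+n≰ωn (fin≤fin p) = 1+n≰n p

0≤p : fin 0 ≤ω p x
0≤p {fin zero}    = fin≤fin z≤n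
0≤p {fin (suc m)} = fin≤fin z≤n
0≤p {ω}           = x≤ω

data Tail : Set where
  constant : ω⁺ → Tail
  linear   : ℕ → Tail

⟦_⟧ : Tail → ℕ → ω⁺
⟦ constant v ⟧ d = v
⟦ linear c   ⟧ d = fin (c + d)

drop : ℕ → Tail → Tail
drop k (constant v) = constant v
drop k (linear c)   = linear (c + k)

shift : ℕ → (ℕ → ω⁺) → ℕ → ω⁺
shift m σ d = σ (m + d)

_↾ω : (ω⁺ → ω⁺) → ℕ → ω⁺
(f ↾ω) n = f (fin n)

record RegularSeq (σ : ℕ → ω⁺) : Set where
  constructor mkRegularSeq
  field
    threshold : ℕ
    tail      : Tail
    eventually : shift threshold σ ≗ ⟦ tail ⟧

shift-⟦⟧ : ∀ k t → shift k ⟦ t ⟧ ≗ ⟦ drop k t ⟧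
shift-⟦⟧ k (constant v) d = refl
shift-⟦⟧ k (linear c)   d = cong fin (sym (+-assoc c k d))

RegularSeq-fromShift : ∀ σ m → shift m σ ≗ τ → RegularSeq τ → RegularSeq σ
RegularSeq-fromShift σ m eq (mkRegularSeq k t tail) =
  mkRegularSeq (m + k) t λ d → trans (cong σ (+-assoc m k d)) (trans (eq (k + d)) (tail d))

RegularSeq-shift : ∀ k → RegularSeq σ → RegularSeq (shift k σ)
RegularSeq-shift {σ = σ} k (mkRegularSeq m t tail) = mkRegularSeq m (drop k t) λ d → begin
  σ (k + (m + d))   ≡⟨ cong σ (x∙yz≈y∙xz k m d) ⟩
  σ (m + (k + d))   ≡⟨ tail (k + d) ⟩
  ⟦ t ⟧ (k + d)     ≡⟨ shift-⟦⟧ k t d ⟩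
  ⟦ drop k t ⟧ d    ∎
  where open ≡-Reasoning

RegularSeq-zipWith : (_⊙_ : ω⁺ → ω⁺ → ω⁺) →
  (∀ s t → RegularSeq (λ d → ⟦ s ⟧ d ⊙ ⟦ t ⟧ d)) →
  RegularSeq σ → RegularSeq τ → RegularSeq (λ n → σ n ⊙ τ n)
RegularSeq-zipWith {τ = τ} _⊙_ tails (mkRegularSeq m s σ-tail) rτ =
  RegularSeq-fromShift _ m (λ d → cong (_⊙ τ (m + d)) (σ-tail d)) ⟦s⟧⊙shiftτ
  where
  ⟦s⟧⊙shiftτ : RegularSeq (λ d → ⟦ s ⟧ d ⊙ shift m τ d)
  ⟦s⟧⊙shiftτ with RegularSeq-shift m rτ
  ... | mkRegularSeq k t τ-tail =
    RegularSeq-fromShift _ k (λ d → cong₂ _⊙_ (shift-⟦⟧ k s d) (τ-tail d)) (tails (drop k s) t)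

⊓ω-tails : ∀ s t → RegularSeq (λ d → ⟦ s ⟧ d ⊓ω ⟦ t ⟧ d)
⊓ω-tails (constant v)       (constant w)       = mkRegularSeq 0 (constant (v ⊓ω w)) λ _ → refl
⊓ω-tails (constant ω)       (linear c)         = mkRegularSeq 0 (linear c) λ _ → refl
⊓ω-tails (constant (fin a)) (linear c)         =
  mkRegularSeq a (constant (fin a)) λ d → cong fin (m≤n⇒m⊓n≡m (m≤n⇒m≤o+n c (m≤m+n a d)))
⊓ω-tails (linear c)         (constant ω)       = mkRegularSeq 0 (linear c) λ _ → refl
⊓ω-tails (linear c)         (constant (fin a)) =
  mkRegularSeq a (constant (fin a)) λ d → cong fin (m≥n⇒m⊓n≡n (m≤n⇒m≤o+n c (m≤m+n a d)))
⊓ω-tails (linear c)         (linear c′)        =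
  mkRegularSeq 0 (linear (c ℕ.⊓ c′)) λ d → cong fin (sym (+-distribʳ-⊓ d c c′))

⊔ω-tails : ∀ s t → RegularSeq (λ d → ⟦ s ⟧ d ⊔ω ⟦ t ⟧ d)
⊔ω-tails (constant v)       (constant w)       = mkRegularSeq 0 (constant (v ⊔ω w)) λ _ → refl
⊔ω-tails (constant ω)       (linear c)         = mkRegularSeq 0 (constant ω) λ _ → refl
⊔ω-tails (constant (fin a)) (linear c)         =
  mkRegularSeq a (linear (c + a)) λ d →
    cong fin (trans (m≤n⇒m⊔n≡n (m≤n⇒m≤o+n c (m≤m+n a d))) (sym (+-assoc c a d)))
⊔ω-tails (linear c)         (constant ω)       = mkRegularSeq 0 (constant ω) λ _ → refl
⊔ω-tails (linear c)         (constant (fin a)) =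
  mkRegularSeq a (linear (c + a)) λ d →
    cong fin (trans (m≥n⇒m⊔n≡m (m≤n⇒m≤o+n c (m≤m+n a d))) (sym (+-assoc c a d)))
⊔ω-tails (linear c)         (linear c′)        =
  mkRegularSeq 0 (linear (c ℕ.⊔ c′)) λ d → cong fin (sym (+-distribʳ-⊔ d c c′))

RegularSeq-∘ : ∀ f g → RegularSeq (f ↾ω) → RegularSeq (g ↾ω) → RegularSeq ((f ∘w g) ↾ω)
RegularSeq-∘ f g rf (mkRegularSeq m t g-tail) =
  RegularSeq-fromShift _ m (λ d → cong f (g-tail d)) (f∘tail t)
  where
  f∘tail : ∀ t → RegularSeq (λ d → f (⟦ t ⟧ d))
  f∘tail (constant v) = mkRegularSeq 0 (constant (f v)) λ _ → refl
  f∘tail (linear c)   = RegularSeq-shift c rf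

linear-offset : ∀ {k j j′ d} → + j ≡ + m ℤ.+ k → + j′ ≡ + (m + d) ℤ.+ k → j′ ≡ j + d
linear-offset {m} {k} {j} {j′} {d} j≡m+k j′≡m+d+k = ℤₚ.+-injective (begin
  + j′                    ≡⟨ j′≡m+d+k ⟩
  + (m + d) ℤ.+ k         ≡⟨ cong (ℤ._+ k) (ℤₚ.pos-+ m d) ⟩
  + m ℤ.+ + d ℤ.+ k       ≡⟨ xy∙z≈xz∙y (+ m) (+ d) k ⟩
  + m ℤ.+ k ℤ.+ + d       ≡⟨ cong (ℤ._+ + d) (sym j≡m+k) ⟩
  + j ℤ.+ + d             ≡⟨ sym (ℤₚ.pos-+ j d) ⟩
  + (j + d)               ∎)
  where open ≡-Reasoning

regular⇒RegularSeq : Regular f → RegularSeq (f ↾ω)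
regular⇒RegularSeq {f} (evConst (m , const)) =
  mkRegularSeq m (constant (f (fin m))) λ d → const (m + d) (m≤m+n m d)
regular⇒RegularSeq {f} (evLin (m , k , lin)) with lin m ≤-refl
... | j , _ , j≡m+k = mkRegularSeq m (linear j) λ d →
  let j′ , fm+d≡j′ , j′≡m+d+k = lin (m + d) (m≤m+n m d)
  in trans fm+d≡j′ (cong fin (linear-offset {m} {k} j≡m+k j′≡m+d+k))

RegularSeq⇒regular : RegularSeq (f ↾ω) → Regular f
RegularSeq⇒regular {f} (mkRegularSeq m (constant v) tail) = evConst (m , constant-from-m)
  where
  constant-from-m : ∀ n → m ≤ n → f (fin n) ≡ f (fin m)
  constant-from-m n m≤n with m≤n⇒∃[o]m+o≡n m≤n
  ... | e , refl = trans (tail e) (sym (subst (λ n → f (fin n) ≡ v) (+-identityʳ m) (tail 0)))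
RegularSeq⇒regular {f} (mkRegularSeq m (linear c) tail) = evLin (m , + c ℤ.- + m , linear-from-m)
  where
  offset : ∀ e → + (c + e) ≡ + (m + e) ℤ.+ (+ c ℤ.- + m)
  offset e = begin
    + (c + e)                         ≡⟨ ℤₚ.pos-+ c e ⟩
    + c ℤ.+ + e                       ≡⟨ cancel-offset (+ m) (+ e) (+ c) ⟩
    + m ℤ.+ + e ℤ.+ (+ c ℤ.- + m)     ≡⟨ cong (ℤ._+ (+ c ℤ.- + m)) (sym (ℤₚ.pos-+ m e)) ⟩
    + (m + e) ℤ.+ (+ c ℤ.- + m)       ∎
    where
    open ≡-Reasoning
    cancel-offset : ∀ i j k → k ℤ.+ j ≡ i ℤ.+ j ℤ.+ (k ℤ.- i)
    cancel-offset = solve-∀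
  linear-from-m : ∀ n → m ≤ n → Σ ℕ λ j → (f (fin n) ≡ fin j) × (+ j ≡ + n ℤ.+ (+ c ℤ.- + m))
  linear-from-m n m≤n with m≤n⇒∃[o]m+o≡n m≤n
  ... | e , refl = c + e , tail e , offset e

limit : Tail → ω⁺
limit (constant v) = v
limit (linear c)   = ω

⟦⟧-mono : ∀ t {d e} → d ≤ e → ⟦ t ⟧ d ≤ω ⟦ t ⟧ e
⟦⟧-mono (constant v) _   = ≤ω-refl
⟦⟧-mono (linear c)   d≤e = fin≤fin (+-monoʳ-≤ c d≤e)

⟦⟧≤limit : ∀ t d → ⟦ t ⟧ d ≤ω limit t
⟦⟧≤limit (constant v) d = ≤ω-refl
⟦⟧≤limit (linear c)   d = x≤ω

limit-least : ∀ t {u} → (∀ d → ⟦ t ⟧ d ≤ω u) → limit t ≤ω u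
limit-least (constant v)         ub = ub 0
limit-least (linear c) {ω}       ub = x≤ω
limit-least (linear c) {fin k}   ub =
  ⊥-elim (1+n≰ωn (≤ω-trans (fin≤fin (m≤n+m (suc k) c)) (ub (suc k))))

pad : ℕ → (ℕ → ω⁺) → ℕ → ω⁺
pad zero    σ n       = σ n
pad (suc N) σ zero    = fin 0
pad (suc N) σ (suc n) = pad N σ n

pad-+ : ∀ N σ d → pad N σ (N + d) ≡ σ d
pad-+ zero    σ d = refl
pad-+ (suc N) σ d = pad-+ N σ d

pad-view : ∀ N σ n → pad N σ n ≡ fin 0 ⊎ Σ ℕ λ d → n ≡ N + d
pad-view zero    σ n       = inj₂ (n , refl)
pad-view (suc N) σ zero    = inj₁ refl
pad-view (suc N) σ (suc n) with pad-view N σ n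
... | inj₁ eq       = inj₁ eq
... | inj₂ (d , eq) = inj₂ (d , cong suc eq)

pad-mono : (∀ {d e} → d ≤ e → σ d ≤ω σ e) → ∀ N {n n′} → n ≤ n′ → pad N σ n ≤ω pad N σ n′
pad-mono σ-mono zero    n≤n′      = σ-mono n≤n′
pad-mono σ-mono (suc N) {zero} _  = 0≤ω
pad-mono σ-mono (suc N) (s≤s n≤n′) = pad-mono σ-mono N n≤n′

pad-≤ : ∀ {u} → (∀ d → σ d ≤ω u) → ∀ N n → pad N σ n ≤ω u
pad-≤ σ≤u zero    n       = σ≤u n
pad-≤ σ≤u (suc N) zero    = 0≤ω
pad-≤ σ≤u (suc N) (suc n) = pad-≤ σ≤u N n

delayed : ℕ → Tail → ω⁺ → ω⁺
delayed N t (fin n) = pad (suc N) ⟦ t ⟧ n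
delayed N t ω       = limit t

delayed-isTimeWarp : ∀ N t → IsTimeWarp (delayed N t)
delayed-isTimeWarp N t = record
  { monotone = monotone
  ; zero↦0   = refl
  ; ω-upper  = pad-≤ (⟦⟧≤limit t) (suc N)
  ; ω-least  = λ u ub → limit-least t λ d → subst (_≤ω u) (pad-+ N ⟦ t ⟧ d) (ub (suc N + d))
  }
  where
  monotone : ∀ x y → x ≤ω y → delayed N t x ≤ω delayed N t y
  monotone (fin n) (fin n′) (fin≤fin n≤n′) = pad-mono (⟦⟧-mono t) (suc N) n≤n′
  monotone (fin n) ω        x≤ω            = pad-≤ (⟦⟧≤limit t) (suc N) n
  monotone ω       ω        x≤ω            = ≤ω-refl

f∘delayed≤p : ∀ {N t} → IsTimeWarp f → (∀ d → f (⟦ t ⟧ d) ≤ω fin (N + d)) →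
  (f ∘w delayed N t) ≤ₚ p
f∘delayed≤p {f} {N} {t} tf bound (fin n) with pad-view (suc N) ⟦ t ⟧ n
... | inj₁ eq rewrite eq | IsTimeWarp.zero↦0 tf = 0≤p
... | inj₂ (d , refl) rewrite pad-+ N ⟦ t ⟧ d = bound d
f∘delayed≤p tf bound ω = x≤ω

monotone-reflect : ∀ {u} → IsTimeWarp f → ¬ f (fin (suc a)) ≤ω u → f y ≤ω u → y ≤ω fin a
monotone-reflect {f} {a} {ω} tf fa+1≰u fω≤u =
  ⊥-elim (fa+1≰u (≤ω-trans (IsTimeWarp.monotone tf _ _ x≤ω) fω≤u))
monotone-reflect {f} {a} {fin n} tf fa+1≰u fn≤u with n ℕ.≤? a
... | yes n≤a = fin≤fin n≤a
... | no  n≰a = ⊥-elim (fa+1≰u (≤ω-trans (IsTimeWarp.monotone tf _ _ (fin≤fin (≰⇒> n≰a))) fn≤u))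

-- The lower bound tests the maximality of f' against the time warp delayed N t.
residual-tail : IsTimeWarp f → IsResidual f f' → ∀ N t →
  (∀ d → f (⟦ t ⟧ d) ≤ω fin (N + d)) →
  (∀ d y → f y ≤ω fin (N + d) → y ≤ω ⟦ t ⟧ d) →
  shift (suc N) (f' ↾ω) ≗ ⟦ t ⟧
residual-tail {f' = f'} tf (_ , f∘f'≤p , greatest) N t bound largest d = ≤ω-antisym
  (largest d _ (f∘f'≤p (fin (suc N + d))))
  (subst (_≤ω f' (fin (suc N + d))) (pad-+ N ⟦ t ⟧ d)
    (greatest (delayed N t) (delayed-isTimeWarp N t) (f∘delayed≤p tf bound) (fin (suc N + d))))

crossing : ∀ (σ : ℕ → ω⁺) k → σ 0 ≡ fin b → σ k ≡ ω →
  Σ ℕ λ a → Σ ℕ λ b′ → (σ a ≡ fin b′) × (σ (suc a) ≡ ω)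
crossing σ zero    σ0≡b σk≡ω with trans (sym σ0≡b) σk≡ω
... | ()
crossing σ (suc k) σ0≡b σk≡ω with σ 1 in σ1≡
... | ω     = 0 , _ , σ0≡b , σ1≡
... | fin c with crossing (shift 1 σ) k σ1≡ σk≡ω
...   | a , b′ , below , above = suc a , b′ , below , above

residual-regular : IsTimeWarp f → IsResidual f f' → RegularSeq (f ↾ω) → RegularSeq (f' ↾ω)
residual-regular {f} tf R (mkRegularSeq m (linear c) tail) =
  mkRegularSeq (suc c) (linear m) (residual-tail tf R c (linear m) (≤ω-reflexive ∘ tail) largest)
  where
  jump : ∀ d → f (fin (suc (m + d))) ≡ fin (suc (c + d))
  jump d = begin
    f (fin (suc (m + d)))   ≡⟨ cong (f ∘ fin) (sym (+-suc m d)) ⟩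
    f (fin (m + suc d))     ≡⟨ tail (suc d) ⟩
    fin (c + suc d)         ≡⟨ cong fin (+-suc c d) ⟩
    fin (suc (c + d))       ∎
    where open ≡-Reasoning
  largest : ∀ d y → f y ≤ω fin (c + d) → y ≤ω fin (m + d)
  largest d _ = monotone-reflect tf λ le → 1+n≰ωn (subst (_≤ω fin (c + d)) (jump d) le)
residual-regular {f} tf R (mkRegularSeq m (constant (fin b)) tail) =
  mkRegularSeq (suc b) (constant ω)
    (residual-tail tf R b (constant ω) (λ d → ≤ω-trans fω≤b (fin≤fin (m≤m+n b d))) λ _ _ _ → x≤ω)
  where
  fω≤b : f ω ≤ω fin b
  fω≤b = IsTimeWarp.ω-least tf (fin b) λ n →
    ≤ω-trans (IsTimeWarp.monotone tf _ _ (fin≤fin (m≤n+m n m))) (≤ω-reflexive (tail n))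
residual-regular {f} tf R (mkRegularSeq m (constant ω) tail)
  with crossing (f ↾ω) (m + 0) (IsTimeWarp.zero↦0 tf) (tail 0)
... | a , b , fa≡b , fa+1≡ω =
  mkRegularSeq (suc b) (constant (fin a))
    (residual-tail tf R b (constant (fin a))
      (λ d → ≤ω-trans (≤ω-reflexive fa≡b) (fin≤fin (m≤m+n b d)))
      λ d _ → monotone-reflect tf λ le → ω≰fin (subst (_≤ω fin (b + d)) fa+1≡ω le))

proposition2p5 : Regular idw ×
    (∀ f g → IsTimeWarp f → IsTimeWarp g → Regular f → Regular g → Regular (f ∧ g)) ×
    (∀ f g → IsTimeWarp f → IsTimeWarp g → Regular f → Regular g → Regular (f ∨ g)) ×
    (∀ f g → IsTimeWarp f → IsTimeWarp g → Regular f → Regular g → Regular (f ∘w g)) ×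
    (∀ f f' → IsTimeWarp f → Regular f → IsResidual f f' → Regular f')
proposition2p5 =
  RegularSeq⇒regular (mkRegularSeq 0 (linear 0) λ _ → refl) ,
  (λ _ _ _ _ rf rg → RegularSeq⇒regular
    (RegularSeq-zipWith _⊓ω_ ⊓ω-tails (regular⇒RegularSeq rf) (regular⇒RegularSeq rg))) ,
  (λ _ _ _ _ rf rg → RegularSeq⇒regular
    (RegularSeq-zipWith _⊔ω_ ⊔ω-tails (regular⇒RegularSeq rf) (regular⇒RegularSeq rg))) ,
  (λ f g _ _ rf rg → RegularSeq⇒regular
    (RegularSeq-∘ f g (regular⇒RegularSeq rf) (regular⇒RegularSeq rg))) ,
  (λ _ _ tf rf R → RegularSeq⇒regular (residual-regular tf R (regular⇒RegularSeq rf)))
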